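{- Let $V$ be a finite set with $|V|\geq 5$, $A=(a_{ij})_{i,j\in V}$ a skew-symmetric matrix, and $Y\subseteq V$ with $|Y|\geq 2$. If $C$ is a clan of $A$ such that $|C\cap Y|=1$ and $V=C\cup Y$, then $A$ is inseparable if and only if $A[Y]$ is inseparable.
   Context: Throughout, matrices have entries in a field $\mathbb{K}$ of characteristic not equal to $2$. $A[W]$ denotes the principal submatrix indexed by $W\subseteq V$. A subset $I\subseteq V$ is a clan of $A$ if for all $i,j\in I$ and $x\in V\setminus I$, $a_{xi}=a_{xj}$ and $a_{ix}=a_{jx}$. A skew-symmetric matrix indexed by $W$ is separable if there is a nonempty proper subset $X\subsetneq W$ such that $X$ and $W\setminus X$ are both clans; otherwise it is inseparable. -}

module Defs where

open import Level using (Level; _⊔_) renaming (suc to lsuc)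
open import Algebra.Bundles using (CommutativeRing)
open import Data.Nat using (ℕ)
open import Data.Fin using (Fin)
open import Data.Fin.Subset using (Subset; _∈_; _∉_; _⊆_; _⊂_; _∩_; ∁; Nonempty)
open import Data.Product using (Σ; ∃; _×_)
open import Relation.Nullary using (¬_)

record Field c ℓ : Set (lsuc (c ⊔ ℓ)) where
  field
    commutativeRing : CommutativeRing c ℓ
  open CommutativeRing commutativeRing public
  field
    0≉1     : ¬ (0# ≈ 1#)
    inverse : ∀ x → ¬ (x ≈ 0#) → ∃ λ y → (x * y) ≈ 1#

module _ {c ℓ : Level} (K : Field c ℓ) where
  open Field K

  CharNot2 : Set ℓ
  CharNot2 = ¬ ((1# + 1#) ≈ 0#)

  Matrix : ℕ → Set c
  Matrix n = Fin n → Fin n → Carrier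

  SkewSymmetric : ∀ {n} → Matrix n → Set ℓ
  SkewSymmetric A = ∀ i j → A j i ≈ - A i j

  -- I is a clan of the principal submatrix A[W] (I ⊆ W): for all i, j ∈ I and
  -- x ∈ W ∖ I, a_xi = a_xj and a_ix = a_jx.  A clan of A is a clan of A[V].
  IsClanIn : ∀ {n} → Matrix n → Subset n → Subset n → Set ℓ
  IsClanIn A W I =
    I ⊆ W ×
    (∀ i j x → i ∈ I → j ∈ I → x ∈ W → x ∉ I →
       (A x i ≈ A x j) × (A i x ≈ A j x))

  Separable : ∀ {n} → Matrix n → Subset n → Set ℓ
  Separable {n} A W =
    Σ (Subset n) λ X → Nonempty X × X ⊂ W × IsClanIn A W X × IsClanIn A W (W ∩ ∁ X)

  Inseparable : ∀ {n} → Matrix n → Subset n → Set ℓ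
  Inseparable A W = ¬ Separable A W

module Submission where

-- Let C be a clan of A with C ∩ Y = {y₀} and C ∪ Y = V.  We work
-- with "splits" of an index set W: two disjoint nonempty clans of A[W]
-- covering W; a split is exactly the data of a separation of A[W].
--
-- * A split (P, Q) of A[Y] with y₀ ∈ P lifts to the split (P ∪ C, Q) of A:
--   adding to a clan of A[Y] a clan of A meeting it gives a clan of A, and a
--   clan of A[Y] avoiding C stays a clan of A, because every vertex of C
--   sees it as y₀ does.
-- * Conversely, let (X, Z) split A.  If Y meets both sides, restricting to Y
--   gives a split of A[Y].  Otherwise Y lies in one side, say X, and some
--   z ∈ Z lies in C ∖ Y.  Skew-symmetry then forces a_{y y₀} = -a_{z y₀} for
--   every y ∈ Y ∖ {y₀}, so ({y₀}, Y ∖ {y₀}) splits A[Y] (|Y| ≥ 2).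

open import Defs
open import Level using (Level)
open import Data.Nat using (ℕ; _≥_; _≤_; _<_)
open import Data.Nat.Properties using (<⇒≱; 1+n≢0; ≤-reflexive)
open import Data.Fin using (Fin; _≟_)
open import Data.Fin.Properties using (any?)
open import Data.Fin.Subset
  using (Subset; ⊤; _∩_; _∪_; ∁; ∣_∣; ⁅_⁆; _∈_; _∉_; _⊆_; Nonempty)
open import Data.Fin.Subset.Properties
open import Data.Product using (_×_; ∃; _,_; proj₁; proj₂)
open import Data.Sum using (_⊎_; inj₁; inj₂; [_,_]) renaming (map to ⊎-map)
open import Data.Empty using (⊥-elim)
open import Relation.Nullary using (¬_; yes; no)
open import Relation.Nullary.Decidable using (_×-dec_; ¬?)
open import Relation.Binary.PropositionalEquality
  using (_≡_; _≢_; refl; sym; trans; cong; subst)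

two-elements⇒2≤∣p∣ : ∀ {n} {p : Subset n} {x y : Fin n} →
                     x ∈ p → y ∈ p → y ≢ x → 2 ≤ ∣ p ∣
two-elements⇒2≤∣p∣ {x = x} {y} x∈p y∈p y≢x =
  subst (_< _) (∣⁅x⁆∣≡1 x) (p⊂q⇒∣p∣<∣q∣ (⁅x⁆⊆p , y , y∈p , x≢y⇒x∉⁅y⁆ y≢x))
  where
  ⁅x⁆⊆p : ⁅ x ⁆ ⊆ _
  ⁅x⁆⊆p z∈⁅x⁆ = subst (_∈ _) (sym (x∈⁅y⁆⇒x≡y x z∈⁅x⁆)) x∈p

the-element : ∀ {n} (p : Subset n) → ∣ p ∣ ≡ 1 →
              ∃ λ x → x ∈ p × (∀ {y} → y ∈ p → y ≡ x)
the-element {n} p ∣p∣≡1 with nonempty? p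
... | no empty = ⊥-elim (1+n≢0 (trans (sym ∣p∣≡1)
                                      (trans (cong ∣_∣ (Empty-unique empty)) (∣⊥∣≡0 n))))
... | yes (x , x∈p) = x , x∈p , unique
  where
  unique : ∀ {y} → y ∈ p → y ≡ x
  unique {y} y∈p with y ≟ x
  ... | yes y≡x = y≡x
  ... | no y≢x  = ⊥-elim (<⇒≱ (two-elements⇒2≤∣p∣ x∈p y∈p y≢x) (≤-reflexive ∣p∣≡1))

another-element : ∀ {n} (p : Subset n) → 2 ≤ ∣ p ∣ → (x : Fin n) →
                  ∃ λ y → y ∈ p × y ≢ x
another-element p 2≤∣p∣ x with any? (λ y → (y ∈? p) ×-dec ¬? (y ≟ x))
... | yes found = found
... | no none   = ⊥-elim (<⇒≱ 2≤∣p∣ (subst (∣ p ∣ ≤_) (∣⁅x⁆∣≡1 x) (p⊆q⇒∣p∣≤∣q∣ p⊆⁅x⁆)))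
  where
  p⊆⁅x⁆ : p ⊆ ⁅ x ⁆
  p⊆⁅x⁆ {y} y∈p with y ≟ x
  ... | yes refl = x∈⁅x⁆ x
  ... | no y≢x   = ⊥-elim (none (y , y∈p , y≢x))

∈-∖⁺ : ∀ {n} {W X : Subset n} {x} → x ∈ W → x ∉ X → x ∈ W ∩ ∁ X
∈-∖⁺ x∈W x∉X = x∈p∩q⁺ (x∈W , x∉p⇒x∈∁p x∉X)

∈-∖⁻ : ∀ {n} {W X : Subset n} {x} → x ∈ W ∩ ∁ X → x ∈ W × x ∉ X
∈-∖⁻ {W = W} {X} x∈W∖X with x∈p∩q⁻ W (∁ X) x∈W∖X
... | x∈W , x∈∁X = x∈W , x∈∁p⇒x∉p x∈∁X

module Clans {c ℓ : Level} (K : Field c ℓ) {n : ℕ} (A : Matrix K n) where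
  open Field K using (_≈_; -_; -‿cong; setoid)
    renaming (refl to ≈-refl; sym to ≈-sym; trans to ≈-trans)
  open import Relation.Binary.Reasoning.Setoid setoid

  record Split (W : Subset n) : Set ℓ where
    field
      left right     : Subset n
      left-clan      : IsClanIn K A W left
      right-clan     : IsClanIn K A W right
      disjoint       : ∀ {x} → x ∈ left → x ∉ right
      cover          : ∀ {x} → x ∈ W → x ∈ left ⊎ x ∈ right
      left-nonempty  : Nonempty left
      right-nonempty : Nonempty right

  swap : ∀ {W} → Split W → Split W
  swap s = record
    { left = right ; right = left ; left-clan = right-clan ; right-clan = left-clan
    ; disjoint = λ x∈r x∈l → disjoint x∈l x∈r
    ; cover = λ x∈W → [ inj₂ , inj₁ ] (cover x∈W)
    ; left-nonempty = right-nonempty ; right-nonempty = left-nonempty }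
    where
    open Split s

  split⇒separable : ∀ {W} → Split W → Separable K A W
  split⇒separable {W} s =
    left , left-nonempty , (proj₁ left-clan , r , r∈W , r∉left) ,
    left-clan , subst (IsClanIn K A W) right≡W∖left right-clan
    where
    open Split s
    r : Fin n
    r = proj₁ right-nonempty
    r∈W : r ∈ W
    r∈W = proj₁ right-clan (proj₂ right-nonempty)
    r∉left : r ∉ left
    r∉left r∈left = disjoint r∈left (proj₂ right-nonempty)
    W∖left⊆right : W ∩ ∁ left ⊆ right
    W∖left⊆right x∈ with ∈-∖⁻ x∈ | cover (proj₁ (∈-∖⁻ x∈))
    ... | _ , x∉left | inj₁ x∈left  = ⊥-elim (x∉left x∈left)
    ... | _ , _      | inj₂ x∈right = x∈right
    right≡W∖left : right ≡ W ∩ ∁ left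
    right≡W∖left = ⊆-antisym (λ x∈ → ∈-∖⁺ (proj₁ right-clan x∈) (λ x∈l → disjoint x∈l x∈))
                             W∖left⊆right

  separable⇒split : ∀ {W} → Separable K A W → Split W
  separable⇒split {W} (X , X≠∅ , (_ , w , w∈W , w∉X) , X-clan , W∖X-clan) = record
    { left = X ; right = W ∩ ∁ X ; left-clan = X-clan ; right-clan = W∖X-clan
    ; disjoint = λ x∈X x∈W∖X → proj₂ (∈-∖⁻ x∈W∖X) x∈X
    ; cover = cover ; left-nonempty = X≠∅ ; right-nonempty = w , ∈-∖⁺ w∈W w∉X }
    where
    cover : ∀ {x} → x ∈ W → x ∈ X ⊎ x ∈ W ∩ ∁ X
    cover {x} x∈W with x ∈? X
    ... | yes x∈X = inj₁ x∈X
    ... | no x∉X  = inj₂ (∈-∖⁺ x∈W x∉X)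

  singleton-clan : ∀ {W v} → v ∈ W → IsClanIn K A W ⁅ v ⁆
  singleton-clan {W} {v} v∈W = ⁅v⁆⊆W , same
    where
    ⁅v⁆⊆W : ⁅ v ⁆ ⊆ W
    ⁅v⁆⊆W x∈ = subst (_∈ W) (sym (x∈⁅y⁆⇒x≡y v x∈)) v∈W
    same : ∀ i j x → i ∈ ⁅ v ⁆ → j ∈ ⁅ v ⁆ → x ∈ W → x ∉ ⁅ v ⁆ →
           (A x i ≈ A x j) × (A i x ≈ A j x)
    same i j x i∈ j∈ _ _ with x∈⁅y⁆⇒x≡y v i∈ | x∈⁅y⁆⇒x≡y v j∈
    ... | refl | refl = ≈-refl , ≈-refl

  clan-restrict : ∀ {W U I} → U ⊆ W → IsClanIn K A W I → IsClanIn K A U (U ∩ I)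
  clan-restrict {W} {U} {I} U⊆W (_ , I-clan) = p∩q⊆p U I , same
    where
    same : ∀ i j x → i ∈ U ∩ I → j ∈ U ∩ I → x ∈ U → x ∉ U ∩ I →
           (A x i ≈ A x j) × (A i x ≈ A j x)
    same i j x i∈ j∈ x∈U x∉ =
      I-clan i j x (p∩q⊆q U I i∈) (p∩q⊆q U I j∈) (U⊆W x∈U) (λ x∈I → x∉ (x∈p∩q⁺ (x∈U , x∈I)))

  split-restrict : ∀ {W U} → U ⊆ W → (s : Split W) →
                   Nonempty (U ∩ Split.left s) → Nonempty (U ∩ Split.right s) → Split U
  split-restrict {W} {U} U⊆W s U∩left≠∅ U∩right≠∅ = record
    { left = U ∩ left ; right = U ∩ right
    ; left-clan = clan-restrict U⊆W left-clan ; right-clan = clan-restrict U⊆W right-clan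
    ; disjoint = λ x∈l x∈r → disjoint (p∩q⊆q U left x∈l) (p∩q⊆q U right x∈r)
    ; cover = λ x∈U → ⊎-map (λ x∈l → x∈p∩q⁺ (x∈U , x∈l)) (λ x∈r → x∈p∩q⁺ (x∈U , x∈r))
                                   (cover (U⊆W x∈U))
    ; left-nonempty = U∩left≠∅ ; right-nonempty = U∩right≠∅ }
    where
    open Split s

  -- Every vertex of C sees W ∖ C in the same way as v does; this gives the
  -- following two ways of turning clans of A[Y] into clans of A[W].
  module Cover {W Y C : Subset n} (Y⊆W : Y ⊆ W) (C-clan : IsClanIn K A W C)
               (outside-C⇒Y : ∀ {x} → x ∈ W → x ∉ C → x ∈ Y)
               {v : Fin n} (v∈C : v ∈ C) (v∈Y : v ∈ Y) where

    like-v : ∀ {i x} → i ∈ C → x ∈ W → x ∉ C → (A x i ≈ A x v) × (A i x ≈ A v x)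
    like-v i∈C x∈W x∉C = proj₂ C-clan _ _ _ i∈C v∈C x∈W x∉C

    clan-union : ∀ {P} → IsClanIn K A Y P → v ∈ P → IsClanIn K A W (P ∪ C)
    clan-union {P} (P⊆Y , P-clan) v∈P = P∪C⊆W , same
      where
      P∪C⊆W : P ∪ C ⊆ W
      P∪C⊆W x∈ with x∈p∪q⁻ P C x∈
      ... | inj₁ x∈P = Y⊆W (P⊆Y x∈P)
      ... | inj₂ x∈C = proj₁ C-clan x∈C
      outside : ∀ {x} → x ∉ P ∪ C → x ∉ P × x ∉ C
      outside x∉ = (λ x∈P → x∉ (x∈p∪q⁺ (inj₁ x∈P))) , (λ x∈C → x∉ (x∈p∪q⁺ (inj₂ x∈C)))
      to-v : ∀ {i x} → i ∈ P ∪ C → x ∈ W → x ∉ P ∪ C → (A x i ≈ A x v) × (A i x ≈ A v x)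
      to-v {i} {x} i∈ x∈W x∉ with x∈p∪q⁻ P C i∈ | outside x∉
      ... | inj₁ i∈P | x∉P , x∉C = P-clan i v x i∈P v∈P (outside-C⇒Y x∈W x∉C) x∉P
      ... | inj₂ i∈C | _   , x∉C = like-v i∈C x∈W x∉C
      same : ∀ i j x → i ∈ P ∪ C → j ∈ P ∪ C → x ∈ W → x ∉ P ∪ C →
             (A x i ≈ A x j) × (A i x ≈ A j x)
      same i j x i∈ j∈ x∈W x∉ with to-v i∈ x∈W x∉ | to-v j∈ x∈W x∉
      ... | col-i , row-i | col-j , row-j =
        ≈-trans col-i (≈-sym col-j) , ≈-trans row-i (≈-sym row-j)

    clan-extend : ∀ {Q} → IsClanIn K A Y Q → (∀ {x} → x ∈ Q → x ∉ C) → IsClanIn K A W Q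
    clan-extend {Q} (Q⊆Y , Q-clan) Q∩C=∅ = (λ x∈Q → Y⊆W (Q⊆Y x∈Q)) , same
      where
      v∉Q : v ∉ Q
      v∉Q v∈Q = Q∩C=∅ v∈Q v∈C
      same : ∀ i j x → i ∈ Q → j ∈ Q → x ∈ W → x ∉ Q → (A x i ≈ A x j) × (A i x ≈ A j x)
      same i j x i∈Q j∈Q x∈W x∉Q with x ∈? C
      ... | no x∉C = Q-clan i j x i∈Q j∈Q (outside-C⇒Y x∈W x∉C) x∉Q
      ... | yes x∈C with like-v x∈C (Y⊆W (Q⊆Y i∈Q)) (Q∩C=∅ i∈Q)
                       | like-v x∈C (Y⊆W (Q⊆Y j∈Q)) (Q∩C=∅ j∈Q)
                       | Q-clan i j v i∈Q j∈Q v∈Y v∉Q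
      ... | col-i , row-i | col-j , row-j | col-v , row-v =
        (begin A x i ≈⟨ row-i ⟩ A v i ≈⟨ col-v ⟩ A v j ≈⟨ row-j ⟨ A x j ∎) ,
        (begin A i x ≈⟨ col-i ⟩ A i v ≈⟨ row-v ⟩ A j v ≈⟨ col-j ⟨ A j x ∎)

  module Skew (skew : SkewSymmetric K A) where

    -- If C and S are clans of A[W], v ∈ C ∩ S and z ∈ C ∖ S, then every
    -- y ∈ S ∖ C satisfies a_{y v} = -a_{z v}: y sees v as it sees z (C is a
    -- clan) and z sees y as it sees v (S is a clan).
    uniform-column : ∀ {W C S v z y} → IsClanIn K A W C → IsClanIn K A W S →
                     v ∈ C → v ∈ S → z ∈ C → z ∈ W → z ∉ S →
                     y ∈ S → y ∈ W → y ∉ C → A y v ≈ - A z v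
    uniform-column {v = v} {z} {y} C-clan S-clan v∈C v∈S z∈C z∈W z∉S y∈S y∈W y∉C = begin
      A y v    ≈⟨ proj₁ (proj₂ C-clan v z y v∈C z∈C y∈W y∉C) ⟩
      A y z    ≈⟨ skew z y ⟩
      - A z y  ≈⟨ -‿cong (proj₁ (proj₂ S-clan y v z y∈S v∈S z∈W z∉S)) ⟩
      - A z v  ∎

    -- If all of W ∖ {v} sees v alike, then W ∖ {v} is a clan of A[W]; the
    -- rows from v agree too, by skew-symmetry.
    point-complement-clan : ∀ {W v} →
      (∀ {i j} → i ∈ W ∩ ∁ ⁅ v ⁆ → j ∈ W ∩ ∁ ⁅ v ⁆ → A i v ≈ A j v) →
      IsClanIn K A W (W ∩ ∁ ⁅ v ⁆)
    point-complement-clan {W} {v} alike = p∩q⊆p W (∁ ⁅ v ⁆) , same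
      where
      same : ∀ i j x → i ∈ W ∩ ∁ ⁅ v ⁆ → j ∈ W ∩ ∁ ⁅ v ⁆ → x ∈ W → x ∉ W ∩ ∁ ⁅ v ⁆ →
             (A x i ≈ A x j) × (A i x ≈ A j x)
      same i j x i∈ j∈ x∈W x∉ with x ≟ v
      ... | no x≢v  = ⊥-elim (x∉ (∈-∖⁺ x∈W (x≢y⇒x∉⁅y⁆ x≢v)))
      ... | yes refl =
        (begin A x i ≈⟨ skew i x ⟩ - A i x ≈⟨ -‿cong (alike i∈ j∈) ⟩ - A j x ≈⟨ skew j x ⟨ A x j ∎) ,
        alike i∈ j∈

module Setting {c ℓ : Level} (K : Field c ℓ) {n : ℕ}
  (A : Matrix K n) (skew : SkewSymmetric K A)
  (Y : Subset n) (2≤∣Y∣ : ∣ Y ∣ ≥ 2)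
  (C : Subset n) (C-clan : IsClanIn K A ⊤ C)
  (∣C∩Y∣≡1 : ∣ C ∩ Y ∣ ≡ 1) (C∪Y≡V : C ∪ Y ≡ ⊤) where
  open Field K using (_≈_; -_) renaming (trans to ≈-trans; sym to ≈-sym)
  open Clans K A
  open Skew skew

  y₀ : Fin n
  y₀ = proj₁ (the-element (C ∩ Y) ∣C∩Y∣≡1)

  y₀∈C : y₀ ∈ C
  y₀∈C = p∩q⊆p C Y (proj₁ (proj₂ (the-element (C ∩ Y) ∣C∩Y∣≡1)))

  y₀∈Y : y₀ ∈ Y
  y₀∈Y = p∩q⊆q C Y (proj₁ (proj₂ (the-element (C ∩ Y) ∣C∩Y∣≡1)))

  only-y₀ : ∀ {y} → y ∈ C → y ∈ Y → y ≡ y₀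
  only-y₀ y∈C y∈Y = proj₂ (proj₂ (the-element (C ∩ Y) ∣C∩Y∣≡1)) (x∈p∩q⁺ (y∈C , y∈Y))

  outside-C⇒Y : ∀ {x} → x ∈ ⊤ → x ∉ C → x ∈ Y
  outside-C⇒Y {x} _ x∉C with x∈p∪q⁻ C Y (subst (x ∈_) (sym C∪Y≡V) ∈⊤)
  ... | inj₁ x∈C = ⊥-elim (x∉C x∈C)
  ... | inj₂ x∈Y = x∈Y

  open Cover (λ _ → ∈⊤) C-clan outside-C⇒Y y₀∈C y₀∈Y

  lift-split-at : (s : Split Y) → y₀ ∈ Split.left s → Split ⊤
  lift-split-at s y₀∈P = record
    { left = P ∪ C ; right = Q
    ; left-clan = clan-union left-clan y₀∈P
    ; right-clan = clan-extend right-clan Q∩C=∅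
    ; disjoint = P∪C∩Q=∅ ; cover = cover′
    ; left-nonempty = y₀ , x∈p∪q⁺ (inj₁ y₀∈P) ; right-nonempty = right-nonempty }
    where
    open Split s renaming (left to P; right to Q)
    Q∩C=∅ : ∀ {x} → x ∈ Q → x ∉ C
    Q∩C=∅ x∈Q x∈C with only-y₀ x∈C (proj₁ right-clan x∈Q)
    ... | refl = disjoint y₀∈P x∈Q
    P∪C∩Q=∅ : ∀ {x} → x ∈ P ∪ C → x ∉ Q
    P∪C∩Q=∅ x∈ x∈Q with x∈p∪q⁻ P C x∈
    ... | inj₁ x∈P = disjoint x∈P x∈Q
    ... | inj₂ x∈C = Q∩C=∅ x∈Q x∈C
    cover′ : ∀ {x} → x ∈ ⊤ → x ∈ P ∪ C ⊎ x ∈ Q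
    cover′ {x} x∈V with x ∈? C
    ... | yes x∈C = inj₁ (x∈p∪q⁺ (inj₂ x∈C))
    ... | no x∉C with cover (outside-C⇒Y x∈V x∉C)
    ...   | inj₁ x∈P = inj₁ (x∈p∪q⁺ (inj₁ x∈P))
    ...   | inj₂ x∈Q = inj₂ x∈Q

  lift-split : Split Y → Split ⊤
  lift-split s with Split.cover s y₀∈Y
  ... | inj₁ y₀∈left  = lift-split-at s y₀∈left
  ... | inj₂ y₀∈right = lift-split-at (swap s) y₀∈right

  split-off-y₀ : (s : Split ⊤) → Y ⊆ Split.left s → Split Y
  split-off-y₀ s Y⊆S = record
    { left = ⁅ y₀ ⁆ ; right = Y ∩ ∁ ⁅ y₀ ⁆
    ; left-clan = singleton-clan y₀∈Y
    ; right-clan = point-complement-clan alike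
    ; disjoint = λ x∈⁅y₀⁆ x∈Y∖y₀ → proj₂ (∈-∖⁻ x∈Y∖y₀) x∈⁅y₀⁆
    ; cover = cover′
    ; left-nonempty = y₀ , x∈⁅x⁆ y₀
    ; right-nonempty = y , ∈-∖⁺ y∈Y (x≢y⇒x∉⁅y⁆ y≢y₀) }
    where
    open Split s renaming (left to S)
    z : Fin n
    z = proj₁ right-nonempty
    z∉S : z ∉ S
    z∉S z∈S = disjoint z∈S (proj₂ right-nonempty)
    z∈C : z ∈ C
    z∈C with z ∈? C
    ... | yes z∈C = z∈C
    ... | no z∉C  = ⊥-elim (z∉S (Y⊆S (outside-C⇒Y ∈⊤ z∉C)))
    column : ∀ {i} → i ∈ Y ∩ ∁ ⁅ y₀ ⁆ → A i y₀ ≈ - A z y₀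
    column i∈ with ∈-∖⁻ i∈
    ... | i∈Y , i∉⁅y₀⁆ =
      uniform-column C-clan left-clan y₀∈C (Y⊆S y₀∈Y) z∈C ∈⊤ z∉S (Y⊆S i∈Y) ∈⊤
        (λ i∈C → x∉⁅y⁆⇒x≢y i∉⁅y₀⁆ (only-y₀ i∈C i∈Y))
    alike : ∀ {i j} → i ∈ Y ∩ ∁ ⁅ y₀ ⁆ → j ∈ Y ∩ ∁ ⁅ y₀ ⁆ → A i y₀ ≈ A j y₀
    alike i∈ j∈ = ≈-trans (column i∈) (≈-sym (column j∈))
    y : Fin n
    y = proj₁ (another-element Y 2≤∣Y∣ y₀)
    y∈Y : y ∈ Y
    y∈Y = proj₁ (proj₂ (another-element Y 2≤∣Y∣ y₀))
    y≢y₀ : y ≢ y₀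
    y≢y₀ = proj₂ (proj₂ (another-element Y 2≤∣Y∣ y₀))
    cover′ : ∀ {x} → x ∈ Y → x ∈ ⁅ y₀ ⁆ ⊎ x ∈ Y ∩ ∁ ⁅ y₀ ⁆
    cover′ {x} x∈Y with x ≟ y₀
    ... | yes refl = inj₁ (x∈⁅x⁆ y₀)
    ... | no x≢y₀  = inj₂ (∈-∖⁺ x∈Y (x≢y⇒x∉⁅y⁆ x≢y₀))

  inside-other-side : (s : Split ⊤) → ¬ Nonempty (Y ∩ Split.right s) → Y ⊆ Split.left s
  inside-other-side s Y∩right=∅ {y} y∈Y with Split.cover s ∈⊤
  ... | inj₁ y∈left  = y∈left
  ... | inj₂ y∈right = ⊥-elim (Y∩right=∅ (y , x∈p∩q⁺ (y∈Y , y∈right)))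

  restrict-split : Split ⊤ → Split Y
  restrict-split s with nonempty? (Y ∩ Split.left s) | nonempty? (Y ∩ Split.right s)
  ... | yes meets-left | yes meets-right = split-restrict (λ _ → ∈⊤) s meets-left meets-right
  ... | _              | no misses-right = split-off-y₀ s (inside-other-side s misses-right)
  ... | no misses-left | yes _          = split-off-y₀ (swap s) (inside-other-side (swap s) misses-left)

open Clans using (split⇒separable; separable⇒split)

lemma4 : {c ℓ : Level} (K : Field c ℓ) → CharNot2 K →
    (n : ℕ) → n ≥ 5 →
    (A : Matrix K n) → SkewSymmetric K A →
    (Y : Subset n) → ∣ Y ∣ ≥ 2 →
    (C : Subset n) → IsClanIn K A ⊤ C →
    ∣ C ∩ Y ∣ ≡ 1 → C ∪ Y ≡ ⊤ →
    (Inseparable K A ⊤ → Inseparable K A Y) × (Inseparable K A Y → Inseparable K A ⊤)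
lemma4 K _ n _ A skew Y 2≤∣Y∣ C C-clan ∣C∩Y∣≡1 C∪Y≡V =
  (λ insep-V sep-Y → insep-V (split⇒separable K A (lift-split (separable⇒split K A sep-Y)))) ,
  (λ insep-Y sep-V → insep-Y (split⇒separable K A (restrict-split (separable⇒split K A sep-V))))
  where open Setting K A skew Y 2≤∣Y∣ C C-clan ∣C∩Y∣≡1 C∪Y≡V
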